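{- Let $\lambda$ be a nonzero real number. For every integer $n\ge0$, \[ B_{n,\lambda}(x)=\sum_{m=0}^{n}J_{m,\lambda}(x)\,S_{1,\lambda}(n,m), \] and in particular $B_{n,\lambda}=\sum_{m=0}^{n}J_{m,\lambda}S_{1,\lambda}(n,m)$.
   Context: For a nonzero real $\lambda$, set $(x)_{0,\lambda}=1$ and $(x)_{n,\lambda}=x(x-\lambda)\cdots(x-(n-1)\lambda)$ for $n\ge1$. Let $e_\lambda^x(t)=\sum_{n\ge0}(x)_{n,\lambda}\frac{t^n}{n!}=(1+\lambda t)^{x/\lambda}$, $e_\lambda(t)=e_\lambda^1(t)$, and $\log_\lambda(1+t)=\frac{1}{\lambda}((1+t)^\lambda-1)$. The degenerate Stirling numbers of the first kind are defined by $\frac{1}{k!}(\log_\lambda(1+t))^k=\sum_{n\ge k}S_{1,\lambda}(n,k)\frac{t^n}{n!}$. The degenerate Bell polynomials are defined by $e_\lambda^x(e_\lambda(t)-1)=\sum_{n\ge0}B_{n,\lambda}(x)\frac{t^n}{n!}$, with $B_{n,\lambda}=B_{n,\lambda}(1)$. The Jindalrae polynomials are defined by $e_\lambda^x\big(e_\lambda(e_\lambda(t)-1)-1\big)=\sum_{n\ge0}J_{n,\lambda}(x)\frac{t^n}{n!}$, with $J_{n,\lambda}=J_{n,\lambda}(1)$. -}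

module Defs where

open import Level using (Level)
open import Data.Nat using (ℕ; zero; suc; _∸_)
open import Data.Nat.Combinatorics using (_C_)
open import Algebra.Bundles using (CommutativeRing)

-- All objects are exponential generating functions, represented by their
-- coefficient sequences: a sequence a : ℕ → R stands for Σ a n t^n / n!.
module _ {c ℓ : Level} (R : CommutativeRing c ℓ) where
  open CommutativeRing R using (Carrier; _+_; _*_; _-_; 0#; 1#)

  natR : ℕ → Carrier
  natR zero    = 0#
  natR (suc n) = 1# + natR n

  sumTo : (ℕ → Carrier) → ℕ → Carrier
  sumTo f zero    = f zero
  sumTo f (suc n) = sumTo f n + f (suc n)

  fallλ : Carrier → Carrier → ℕ → Carrier
  fallλ x lam zero    = 1#
  fallλ x lam (suc n) = fallλ x lam n * (x - natR n * lam)

  -- egfPow g k n : the coefficient of t^n/n! in g(t)^k / k!, for an egf g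
  -- with g(0) = 0 (partial Bell polynomial recurrence: the block containing
  -- the first element has size i+1).
  egfPow : (ℕ → Carrier) → ℕ → ℕ → Carrier
  egfPow g zero    zero    = 1#
  egfPow g zero    (suc n) = 0#
  egfPow g (suc k) zero    = 0#
  egfPow g (suc k) (suc n) =
    sumTo (λ i → natR (n C i) * (g (suc i) * egfPow g k (n ∸ i))) n

  -- coefficients of e_λ^x(g(t)) = Σ_k (x)_{k,λ} g(t)^k / k!, for g(0) = 0
  compEλ : Carrier → Carrier → (ℕ → Carrier) → ℕ → Carrier
  compEλ lam x g n = sumTo (λ k → fallλ x lam k * egfPow g k n) n

  -- coefficients of e_λ(t) - 1
  eλm1 : Carrier → ℕ → Carrier
  eλm1 lam zero    = 0#
  eλm1 lam (suc n) = fallλ 1# lam (suc n)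

  -- coefficients of log_λ(1+t) = ((1+t)^λ - 1)/λ :
  -- coefficient of t^(n+1)/(n+1)! is λ(λ-1)⋯(λ-n)/λ = (λ-1)(λ-2)⋯(λ-n)
  logλ : Carrier → ℕ → Carrier
  logλ lam zero    = 0#
  logλ lam (suc n) = fallλ (lam - 1#) 1# n

  S1λ : Carrier → ℕ → ℕ → Carrier
  S1λ lam n k = egfPow (logλ lam) k n

  Bellλ : Carrier → Carrier → ℕ → Carrier
  Bellλ lam x n = compEλ lam x (eλm1 lam) n

  eλeλm1m1 : Carrier → ℕ → Carrier
  eλeλm1m1 lam zero    = 0#
  eλeλm1m1 lam (suc n) = compEλ lam 1# (eλm1 lam) (suc n)

  Jindλ : Carrier → Carrier → ℕ → Carrier
  Jindλ lam x n = compEλ lam x (eλeλm1m1 lam) n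

-- In generating-function terms B_λ(x; t) = e_λ^x(e_λ(t) - 1), while the right-hand
-- side is the coefficient of t^n/n! in J_λ(x; log_λ(1 + t)), and J_λ(x; u) is
-- e_λ^x(h(u)) with h(u) = e_λ(e_λ(u) - 1) - 1.  Composition of series is
-- associative, so it suffices that h(log_λ(1 + t)) = e_λ(t) - 1, which follows
-- once log_λ(1 + t) is a right inverse of e_λ(t) - 1.  That in turn is the identity
-- e_λ^x(log_λ(1 + t)) = (1 + t)^x, which after differentiation reduces to the
-- Vandermonde convolution of falling factorials.  All identities are proved on
-- coefficient sequences over an arbitrary commutative ring, by induction on the
-- degree through the chain rule (F ∘ g)' = g' · (F' ∘ g); nothing is divided by
-- λ.

module Submission where

open import Defs
open import Level using (Level)
open import Data.Nat.Base as ℕ using (ℕ; zero; suc; _∸_; _≤_; _<_; _≤′_; ≤′-refl; ≤′-step; z≤n; s≤s)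
open import Data.Nat.Properties using (≤-refl; ≤-trans; ≤-<-trans; m≤n⇒m≤1+n; m∸n≤m; n<1+n; +-∸-assoc; ≤⇒≤′; ≤′⇒≤)
open import Data.Nat.Combinatorics using (_C_; nCk+nC[k+1]≡[n+1]C[k+1]; k>n⇒nCk≡0)
open import Data.Nat.Induction using (<-rec)
open import Data.Product using (_×_; _,_)
open import Relation.Nullary using (¬_)
import Relation.Binary.PropositionalEquality as ≡
open import Algebra.Bundles using (CommutativeRing)
import Algebra.Properties.AbelianGroup as AbelianGroupProperties
import Algebra.Properties.CommutativeSemigroup as CommutativeSemigroupProperties
import Algebra.Solver.CommutativeMonoid as CommutativeMonoidSolver
import Relation.Binary.Reasoning.Setoid as SetoidReasoning

module ExponentialSeries {c ℓ : Level} (R : CommutativeRing c ℓ) where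
  open CommutativeRing R
  open SetoidReasoning setoid
  open AbelianGroupProperties +-abelianGroup using (ε⁻¹≈ε; ⁻¹-∙-comm)
  open CommutativeSemigroupProperties +-commutativeSemigroup
    using () renaming (interchange to +-interchange; x∙yz≈y∙xz to x+[y+z]≈y+[x+z]; xy∙z≈xz∙y to [x+y]+z≈[x+z]+y)
  open CommutativeSemigroupProperties *-commutativeSemigroup
    using () renaming (x∙yz≈y∙xz to x*[y*z]≈y*[x*z])
  module +-Solver = CommutativeMonoidSolver +-commutativeMonoid
  module *-Solver = CommutativeMonoidSolver *-commutativeMonoid

  Series : Set c
  Series = ℕ → Carrier

  infix  4 _≋_
  infixl 6 _⊞_
  infixl 7 _⊛_
  infixr 7 _·_

  _≋_ : Series → Series → Set ℓ
  a ≋ b = ∀ n → a n ≈ b n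

  _⊞_ : Series → Series → Series
  (a ⊞ b) n = a n + b n

  _·_ : Carrier → Series → Series
  (s · a) n = s * a n

  ∂ : Series → Series
  ∂ a n = a (suc n)

  ∑ : Series → ℕ → Carrier
  ∑ = sumTo R

  natR-+ : ∀ m n → natR R (m ℕ.+ n) ≈ natR R m + natR R n
  natR-+ zero    n = sym (+-identityˡ _)
  natR-+ (suc m) n = trans (+-congˡ (natR-+ m n)) (sym (+-assoc _ _ _))

  natR-1 : natR R 1 ≈ 1#
  natR-1 = +-identityʳ 1#

  ∑-cong≤ : ∀ {f g} n → (∀ {i} → i ≤ n → f i ≈ g i) → ∑ f n ≈ ∑ g n
  ∑-cong≤ zero    f≈g = f≈g z≤n
  ∑-cong≤ (suc n) f≈g = +-cong (∑-cong≤ n (λ i≤n → f≈g (m≤n⇒m≤1+n i≤n))) (f≈g ≤-refl)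

  ∑-cong : ∀ {f g} → f ≋ g → ∀ n → ∑ f n ≈ ∑ g n
  ∑-cong f≈g n = ∑-cong≤ n (λ {i} _ → f≈g i)

  ∑-zero : ∀ f n → (∀ {i} → i ≤ n → f i ≈ 0#) → ∑ f n ≈ 0#
  ∑-zero f zero    f≈0 = f≈0 z≤n
  ∑-zero f (suc n) f≈0 =
    trans (+-cong (∑-zero f n (λ i≤n → f≈0 (m≤n⇒m≤1+n i≤n))) (f≈0 ≤-refl)) (+-identityʳ 0#)

  ∑-distrib-+ : ∀ f g n → ∑ (f ⊞ g) n ≈ ∑ f n + ∑ g n
  ∑-distrib-+ f g zero    = refl
  ∑-distrib-+ f g (suc n) = trans (+-congʳ (∑-distrib-+ f g n)) (+-interchange _ _ _ _)

  *-distribˡ-∑ : ∀ s f n → s * ∑ f n ≈ ∑ (s · f) n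
  *-distribˡ-∑ s f zero    = refl
  *-distribˡ-∑ s f (suc n) = trans (distribˡ _ _ _) (+-congʳ (*-distribˡ-∑ s f n))

  ∑-suc : ∀ f n → ∑ f (suc n) ≈ f 0 + ∑ (∂ f) n
  ∑-suc f zero    = refl
  ∑-suc f (suc n) = trans (+-congʳ (∑-suc f n)) (+-assoc _ _ _)

  ∑-comm : ∀ (f : ℕ → ℕ → Carrier) m n → ∑ (λ k → ∑ (f k) n) m ≈ ∑ (λ i → ∑ (λ k → f k i) m) n
  ∑-comm f zero    n = refl
  ∑-comm f (suc m) n = trans (+-congʳ (∑-comm f m n)) (sym (∑-distrib-+ _ _ n))

  ∑-truncate : ∀ f {m n} → m ≤ n → (∀ {k} → m < k → k ≤ n → f k ≈ 0#) → ∑ f n ≈ ∑ f m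
  ∑-truncate f m≤n tail≈0 = go (≤⇒≤′ m≤n) tail≈0
    where
    go : ∀ {m n} → m ≤′ n → (∀ {k} → m < k → k ≤ n → f k ≈ 0#) → ∑ f n ≈ ∑ f m
    go ≤′-refl          _      = refl
    go (≤′-step m≤′n) tail≈0 = trans
      (+-cong (go m≤′n (λ m<k k≤n → tail≈0 m<k (m≤n⇒m≤1+n k≤n))) (tail≈0 (s≤s (≤′⇒≤ m≤′n)) ≤-refl))
      (+-identityʳ _)

  _⊛_ : Series → Series → Series
  (a ⊛ b) n = ∑ (λ i → natR R (n C i) * (a i * b (n ∸ i))) n

  ⊛-cong≤ : ∀ {a a' b b'} n → (∀ {i} → i ≤ n → a i ≈ a' i) → (∀ {i} → i ≤ n → b i ≈ b' i) →
            (a ⊛ b) n ≈ (a' ⊛ b') n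
  ⊛-cong≤ n a≈a' b≈b' = ∑-cong≤ n (λ {i} i≤n → *-congˡ (*-cong (a≈a' i≤n) (b≈b' (m∸n≤m n i))))

  ⊛-cong : ∀ {a a' b b'} → a ≋ a' → b ≋ b' → a ⊛ b ≋ a' ⊛ b'
  ⊛-cong a≈a' b≈b' n = ⊛-cong≤ n (λ {i} _ → a≈a' i) (λ {i} _ → b≈b' i)

  ⊛-distribˡ-⊞ : ∀ a b d → a ⊛ (b ⊞ d) ≋ a ⊛ b ⊞ a ⊛ d
  ⊛-distribˡ-⊞ a b d n =
    trans (∑-cong (λ i → trans (*-congˡ (distribˡ _ _ _)) (distribˡ _ _ _)) n) (∑-distrib-+ _ _ n)

  ⊛-distribʳ-⊞ : ∀ a b d → (a ⊞ b) ⊛ d ≋ a ⊛ d ⊞ b ⊛ d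
  ⊛-distribʳ-⊞ a b d n =
    trans (∑-cong (λ i → trans (*-congˡ (distribʳ _ _ _)) (distribˡ _ _ _)) n) (∑-distrib-+ _ _ n)

  ·-⊛ : ∀ s a b → (s · a) ⊛ b ≋ s · (a ⊛ b)
  ·-⊛ s a b n = trans
    (∑-cong (λ i → *-Solver.solve 4 (λ x y z w → x *-Solver.⊕ ((y *-Solver.⊕ z) *-Solver.⊕ w)
                                          *-Solver.⊜ y *-Solver.⊕ (x *-Solver.⊕ (z *-Solver.⊕ w))) refl _ s _ _) n)
    (sym (*-distribˡ-∑ s _ n))

  ⊛-· : ∀ s a b → a ⊛ (s · b) ≋ s · (a ⊛ b)
  ⊛-· s a b n = trans
    (∑-cong (λ i → *-Solver.solve 4 (λ x y z w → x *-Solver.⊕ (y *-Solver.⊕ (z *-Solver.⊕ w))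
                                          *-Solver.⊜ z *-Solver.⊕ (x *-Solver.⊕ (y *-Solver.⊕ w))) refl _ _ s _) n)
    (sym (*-distribˡ-∑ s _ n))

  -- Pascal's rule splits each binomial coefficient of degree n + 1 in two.
  ∂-⊛ : ∀ a b → ∂ (a ⊛ b) ≋ ∂ a ⊛ b ⊞ a ⊛ ∂ b
  ∂-⊛ a b n = begin
      (a ⊛ b) (suc n)
    ≈⟨ ∑-suc _ n ⟩
      first + ∑ (λ i → natR R (suc n C suc i) * (a (suc i) * b (n ∸ i))) n
    ≈⟨ +-congˡ (∑-cong (λ i → trans (*-congʳ (pascal i)) (distribʳ _ _ _)) n) ⟩
      first + ∑ ((λ i → natR R (n C i) * (a (suc i) * b (n ∸ i))) ⊞ rest) n
    ≈⟨ +-congˡ (∑-distrib-+ _ _ n) ⟩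
      first + ((∂ a ⊛ b) n + ∑ rest n)
    ≈⟨ x+[y+z]≈y+[x+z] first _ _ ⟩
      (∂ a ⊛ b) n + (first + ∑ rest n)
    ≈⟨ +-congˡ (sym (∑-suc shifted n)) ⟩
      (∂ a ⊛ b) n + ∑ shifted (suc n)
    ≈⟨ +-congˡ (trans (+-cong (∑-cong≤ n (λ i≤n → *-congˡ (*-congˡ (reflexive (≡.cong b (+-∸-assoc 1 i≤n))))))
                               (trans (*-congʳ (reflexive (≡.cong (natR R) (k>n⇒nCk≡0 (n<1+n n))))) (zeroˡ _)))
                        (+-identityʳ _)) ⟩
      (∂ a ⊛ b) n + (a ⊛ ∂ b) n
    ∎
    where
    first = natR R 1 * (a 0 * b (suc n))
    rest = λ i → natR R (n C suc i) * (a (suc i) * b (n ∸ i))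
    shifted = λ i → natR R (n C i) * (a i * b (suc n ∸ i))
    pascal : ∀ i → natR R (suc n C suc i) ≈ natR R (n C i) + natR R (n C suc i)
    pascal i = trans (reflexive (≡.cong (natR R) (≡.sym (nCk+nC[k+1]≡[n+1]C[k+1] n i)))) (natR-+ (n C i) (n C suc i))

  ⊛-comm : ∀ a b → a ⊛ b ≋ b ⊛ a
  ⊛-comm a b zero    = *-congˡ (*-comm _ _)
  ⊛-comm a b (suc n) = begin
      (a ⊛ b) (suc n)                   ≈⟨ ∂-⊛ a b n ⟩
      (∂ a ⊛ b) n + (a ⊛ ∂ b) n         ≈⟨ +-cong (⊛-comm (∂ a) b n) (⊛-comm a (∂ b) n) ⟩
      (b ⊛ ∂ a) n + (∂ b ⊛ a) n         ≈⟨ +-comm _ _ ⟩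
      (∂ b ⊛ a) n + (b ⊛ ∂ a) n         ≈⟨ ∂-⊛ b a n ⟨
      (b ⊛ a) (suc n)                   ∎

  ⊛-assoc : ∀ a b d → a ⊛ (b ⊛ d) ≋ (a ⊛ b) ⊛ d
  ⊛-assoc a b d zero = *-Solver.solve 5
    (λ c x y z c' → c *-Solver.⊕ (x *-Solver.⊕ (c' *-Solver.⊕ (y *-Solver.⊕ z)))
                    *-Solver.⊜ c' *-Solver.⊕ ((c *-Solver.⊕ (x *-Solver.⊕ y)) *-Solver.⊕ z))
    refl _ (a 0) (b 0) (d 0) _
  ⊛-assoc a b d (suc n) = begin
      (a ⊛ (b ⊛ d)) (suc n)
    ≈⟨ ∂-⊛ a (b ⊛ d) n ⟩
      (∂ a ⊛ (b ⊛ d)) n + (a ⊛ ∂ (b ⊛ d)) n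
    ≈⟨ +-congˡ (trans (⊛-cong {a = a} (λ _ → refl) (∂-⊛ b d) n) (⊛-distribˡ-⊞ a (∂ b ⊛ d) (b ⊛ ∂ d) n)) ⟩
      (∂ a ⊛ (b ⊛ d)) n + ((a ⊛ (∂ b ⊛ d)) n + (a ⊛ (b ⊛ ∂ d)) n)
    ≈⟨ +-cong (⊛-assoc (∂ a) b d n) (+-cong (⊛-assoc a (∂ b) d n) (⊛-assoc a b (∂ d) n)) ⟩
      ((∂ a ⊛ b) ⊛ d) n + (((a ⊛ ∂ b) ⊛ d) n + ((a ⊛ b) ⊛ ∂ d) n)
    ≈⟨ +-assoc _ _ _ ⟨
      ((∂ a ⊛ b) ⊛ d) n + ((a ⊛ ∂ b) ⊛ d) n + ((a ⊛ b) ⊛ ∂ d) n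
    ≈⟨ +-congʳ (trans (⊛-cong {b = d} (∂-⊛ a b) (λ _ → refl) n) (⊛-distribʳ-⊞ (∂ a ⊛ b) (a ⊛ ∂ b) d n)) ⟨
      (∂ (a ⊛ b) ⊛ d) n + ((a ⊛ b) ⊛ ∂ d) n
    ≈⟨ ∂-⊛ (a ⊛ b) d n ⟨
      ((a ⊛ b) ⊛ d) (suc n)
    ∎

  ι : Series
  ι 1 = 1#
  ι _ = 0#

  ∂ι-⊛ : ∀ b → ∂ ι ⊛ b ≋ b
  ∂ι-⊛ b zero    = trans (*-congʳ natR-1) (trans (*-identityˡ _) (*-identityˡ _))
  ∂ι-⊛ b (suc n) = trans (∑-suc _ n)
    (trans (+-cong (trans (*-congʳ natR-1) (trans (*-identityˡ _) (*-identityˡ _)))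
                   (∑-zero _ n (λ _ → trans (*-congˡ (zeroˡ _)) (zeroʳ _))))
           (+-identityʳ _))

  -- Composition F(g(t)); the constant term g 0 is ignored.
  _⊚_ : Series → Series → Series
  (F ⊚ g) n = ∑ (λ k → F k * egfPow R g k n) n

  egfPow-vanish : ∀ g {k n} → n < k → egfPow R g k n ≈ 0#
  egfPow-vanish g {suc k} {zero}  _           = refl
  egfPow-vanish g {suc k} {suc n} (s≤s n<k) = ∑-zero _ n (λ {i} _ →
    trans (*-congˡ (trans (*-congˡ (egfPow-vanish g (≤-<-trans (m∸n≤m n i) n<k))) (zeroʳ _))) (zeroʳ _))

  egfPow-cong : ∀ {g g'} → ∂ g ≋ ∂ g' → ∀ k → egfPow R g k ≋ egfPow R g' k
  egfPow-cong g≈g' zero    zero    = refl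
  egfPow-cong g≈g' zero    (suc n) = refl
  egfPow-cong g≈g' (suc k) zero    = refl
  egfPow-cong g≈g' (suc k) (suc n) = ∑-cong (λ i → *-congˡ (*-cong (g≈g' i) (egfPow-cong g≈g' k (n ∸ i)))) n

  ⊚-congˡ : ∀ {F F'} g → F ≋ F' → F ⊚ g ≋ F' ⊚ g
  ⊚-congˡ g F≈F' n = ∑-cong (λ k → *-congʳ (F≈F' k)) n

  ⊚-congʳ : ∀ F {g g'} → ∂ g ≋ ∂ g' → F ⊚ g ≋ F ⊚ g'
  ⊚-congʳ F g≈g' n = ∑-cong (λ k → *-congˡ (egfPow-cong g≈g' k n)) n

  ⊚-distribʳ-⊞ : ∀ F G g → (F ⊞ G) ⊚ g ≋ F ⊚ g ⊞ G ⊚ g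
  ⊚-distribʳ-⊞ F G g n = trans (∑-cong (λ k → distribʳ _ _ _) n) (∑-distrib-+ _ _ n)

  ·-⊚ : ∀ s F g → (s · F) ⊚ g ≋ s · (F ⊚ g)
  ·-⊚ s F g n = trans (∑-cong (λ k → *-assoc _ _ _) n) (sym (*-distribˡ-∑ s _ n))

  -- The recurrence defining egfPow is exactly d/dt (g^(k+1)/(k+1)!) = g' · g^k/k!.
  ⊚-chainRule : ∀ F g → ∂ (F ⊚ g) ≋ ∂ g ⊛ (∂ F ⊚ g)
  ⊚-chainRule F g n = begin
      (F ⊚ g) (suc n)
    ≈⟨ ∑-suc _ n ⟩
      F 0 * 0# + ∑ (λ k → F (suc k) * egfPow R g (suc k) (suc n)) n
    ≈⟨ trans (+-congʳ (zeroʳ _)) (+-identityˡ _) ⟩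
      ∑ (λ k → F (suc k) * ∑ (λ i → natR R (n C i) * (g (suc i) * egfPow R g k (n ∸ i))) n) n
    ≈⟨ ∑-cong (λ k → trans (*-distribˡ-∑ _ _ n)
                       (∑-cong (λ i → trans (x*[y*z]≈y*[x*z] _ _ _) (*-congˡ (x*[y*z]≈y*[x*z] _ _ _))) n)) n ⟩
      ∑ (λ k → ∑ (term k) n) n
    ≈⟨ ∑-comm term n n ⟩
      ∑ (λ i → ∑ (λ k → term k i) n) n
    ≈⟨ ∑-cong (λ i → trans (sym (*-distribˡ-∑ _ _ n)) (*-congˡ (sym (*-distribˡ-∑ _ _ n)))) n ⟩
      ∑ (λ i → natR R (n C i) * (g (suc i) * ∑ (λ k → F (suc k) * egfPow R g k (n ∸ i)) n)) n
    ≈⟨ ∑-cong≤ n (λ {i} _ → *-congˡ (*-congˡ (∑-truncate _ (m∸n≤m n i)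
          (λ n∸i<k _ → trans (*-congˡ (egfPow-vanish g n∸i<k)) (zeroʳ _))))) ⟩
      (∂ g ⊛ (∂ F ⊚ g)) n
    ∎
    where
    term = λ k i → natR R (n C i) * (g (suc i) * (F (suc k) * egfPow R g k (n ∸ i)))

  ⊚-congˡ-∂ : ∀ {F F'} g → ∂ F ≋ ∂ F' → ∂ (F ⊚ g) ≋ ∂ (F' ⊚ g)
  ⊚-congˡ-∂ {F} {F'} g F≈F' n = begin
    (F ⊚ g) (suc n)          ≈⟨ ⊚-chainRule F g n ⟩
    (∂ g ⊛ (∂ F ⊚ g)) n      ≈⟨ ⊛-cong {a = ∂ g} (λ _ → refl) (⊚-congˡ g F≈F') n ⟩
    (∂ g ⊛ (∂ F' ⊚ g)) n     ≈⟨ ⊚-chainRule F' g n ⟨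
    (F' ⊚ g) (suc n)         ∎

  ⊚-identityʳ : ∀ F → F ⊚ ι ≋ F
  ⊚-identityʳ F zero    = *-identityʳ _
  ⊚-identityʳ F (suc n) =
    trans (⊚-chainRule F ι n) (trans (∂ι-⊛ (∂ F ⊚ ι) n) (⊚-identityʳ (∂ F) n))

  ⊚-distribʳ-⊛ : ∀ L P Q → (P ⊛ Q) ⊚ L ≋ (P ⊚ L) ⊛ (Q ⊚ L)
  ⊚-distribʳ-⊛ L P Q n = <-rec Distrib step n P Q
    where
    Distrib : ℕ → Set _
    Distrib j = ∀ P Q → ((P ⊛ Q) ⊚ L) j ≈ ((P ⊚ L) ⊛ (Q ⊚ L)) j
    step : ∀ j → (∀ {i} → i < j → Distrib i) → Distrib j
    step zero _ P Q = *-Solver.solve 3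
      (λ c p q → (c *-Solver.⊕ (p *-Solver.⊕ q)) *-Solver.⊕ *-Solver.id
                 *-Solver.⊜ c *-Solver.⊕ ((p *-Solver.⊕ *-Solver.id) *-Solver.⊕ (q *-Solver.⊕ *-Solver.id)))
      refl _ (P 0) (Q 0)
    step (suc j) ih P Q = begin
        ((P ⊛ Q) ⊚ L) (suc j)
      ≈⟨ ⊚-chainRule (P ⊛ Q) L j ⟩
        (∂ L ⊛ (∂ (P ⊛ Q) ⊚ L)) j
      ≈⟨ ⊛-cong {a = ∂ L} (λ _ → refl)
           (λ i → trans (⊚-congˡ L (∂-⊛ P Q) i) (⊚-distribʳ-⊞ (∂ P ⊛ Q) (P ⊛ ∂ Q) L i)) j ⟩
        (∂ L ⊛ ((∂ P ⊛ Q) ⊚ L ⊞ (P ⊛ ∂ Q) ⊚ L)) j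
      ≈⟨ ⊛-cong≤ {a = ∂ L} j (λ _ → refl) (λ i≤j → +-cong (ih (s≤s i≤j) (∂ P) Q) (ih (s≤s i≤j) P (∂ Q))) ⟩
        (∂ L ⊛ ((∂ P ⊚ L) ⊛ (Q ⊚ L) ⊞ (P ⊚ L) ⊛ (∂ Q ⊚ L))) j
      ≈⟨ ⊛-distribˡ-⊞ (∂ L) ((∂ P ⊚ L) ⊛ (Q ⊚ L)) ((P ⊚ L) ⊛ (∂ Q ⊚ L)) j ⟩
        (∂ L ⊛ ((∂ P ⊚ L) ⊛ (Q ⊚ L))) j + (∂ L ⊛ ((P ⊚ L) ⊛ (∂ Q ⊚ L))) j
      ≈⟨ +-cong (⊛-assoc (∂ L) (∂ P ⊚ L) (Q ⊚ L) j)
                (trans (⊛-assoc (∂ L) (P ⊚ L) (∂ Q ⊚ L) j)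
                (trans (⊛-cong {b = ∂ Q ⊚ L} (⊛-comm (∂ L) (P ⊚ L)) (λ _ → refl) j)
                       (sym (⊛-assoc (P ⊚ L) (∂ L) (∂ Q ⊚ L) j)))) ⟩
        ((∂ L ⊛ (∂ P ⊚ L)) ⊛ (Q ⊚ L)) j + ((P ⊚ L) ⊛ (∂ L ⊛ (∂ Q ⊚ L))) j
      ≈⟨ +-cong (⊛-cong {b = Q ⊚ L} (⊚-chainRule P L) (λ _ → refl) j)
                (⊛-cong {a = P ⊚ L} (λ _ → refl) (⊚-chainRule Q L) j) ⟨
        (∂ (P ⊚ L) ⊛ (Q ⊚ L)) j + ((P ⊚ L) ⊛ ∂ (Q ⊚ L)) j
      ≈⟨ ∂-⊛ (P ⊚ L) (Q ⊚ L) j ⟨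
        ((P ⊚ L) ⊛ (Q ⊚ L)) (suc j)
      ∎

  ⊚-assoc : ∀ F G L → (F ⊚ G) ⊚ L ≋ F ⊚ (G ⊚ L)
  ⊚-assoc F G L n = <-rec Assoc step n F
    where
    Assoc : ℕ → Set _
    Assoc j = ∀ F → ((F ⊚ G) ⊚ L) j ≈ (F ⊚ (G ⊚ L)) j
    step : ∀ j → (∀ {i} → i < j → Assoc i) → Assoc j
    step zero    _  F = *-identityʳ _
    step (suc j) ih F = begin
        ((F ⊚ G) ⊚ L) (suc j)
      ≈⟨ ⊚-chainRule (F ⊚ G) L j ⟩
        (∂ L ⊛ (∂ (F ⊚ G) ⊚ L)) j
      ≈⟨ ⊛-cong {a = ∂ L} (λ _ → refl)
           (λ i → trans (⊚-congˡ L (⊚-chainRule F G) i) (⊚-distribʳ-⊛ L (∂ G) (∂ F ⊚ G) i)) j ⟩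
        (∂ L ⊛ ((∂ G ⊚ L) ⊛ ((∂ F ⊚ G) ⊚ L))) j
      ≈⟨ ⊛-cong≤ {a = ∂ L} j (λ _ → refl) (λ i≤j → ⊛-cong≤ {a = ∂ G ⊚ L} _ (λ _ → refl)
           (λ i'≤i → ih (s≤s (≤-trans i'≤i i≤j)) (∂ F))) ⟩
        (∂ L ⊛ ((∂ G ⊚ L) ⊛ (∂ F ⊚ (G ⊚ L)))) j
      ≈⟨ ⊛-assoc (∂ L) (∂ G ⊚ L) (∂ F ⊚ (G ⊚ L)) j ⟩
        ((∂ L ⊛ (∂ G ⊚ L)) ⊛ (∂ F ⊚ (G ⊚ L))) j
      ≈⟨ ⊛-cong {b = ∂ F ⊚ (G ⊚ L)} (⊚-chainRule G L) (λ _ → refl) j ⟨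
        (∂ (G ⊚ L) ⊛ (∂ F ⊚ (G ⊚ L))) j
      ≈⟨ ⊚-chainRule F (G ⊚ L) j ⟨
        (F ⊚ (G ⊚ L)) (suc j)
      ∎

  fallλ-cong : ∀ {x y} l → x ≈ y → fallλ R x l ≋ fallλ R y l
  fallλ-cong l x≈y zero    = refl
  fallλ-cong l x≈y (suc k) = *-cong (fallλ-cong l x≈y k) (+-congʳ x≈y)

  x-[1+k]l≈[x-l]-kl : ∀ x l k → x - (1# + k) * l ≈ (x - l) - k * l
  x-[1+k]l≈[x-l]-kl x l k = begin
    x - (1# + k) * l         ≈⟨ +-congˡ (-‿cong (trans (distribʳ _ _ _) (+-congʳ (*-identityˡ _)))) ⟩
    x - (l + k * l)          ≈⟨ +-congˡ (⁻¹-∙-comm _ _) ⟨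
    x + (- l + - (k * l))    ≈⟨ +-assoc _ _ _ ⟨
    (x - l) - k * l          ∎

  ∂-fallλ : ∀ x l → ∂ (fallλ R x l) ≋ x · fallλ R (x - l) l
  ∂-fallλ x l zero    = trans (*-identityˡ _)
    (trans (+-congˡ (trans (-‿cong (zeroˡ _)) ε⁻¹≈ε)) (trans (+-identityʳ _) (sym (*-identityʳ _))))
  ∂-fallλ x l (suc k) = trans (*-cong (∂-fallλ x l k) (x-[1+k]l≈[x-l]-kl x l (natR R k))) (*-assoc _ _ _)

  fallλ-vandermonde : ∀ a b l → fallλ R a l ⊛ fallλ R b l ≋ fallλ R (a + b) l
  fallλ-vandermonde a b l zero    = trans (*-congʳ natR-1) (trans (*-identityˡ _) (*-identityˡ _))
  fallλ-vandermonde a b l (suc n) = begin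
      (fallλ R a l ⊛ fallλ R b l) (suc n)
    ≈⟨ ∂-⊛ (fallλ R a l) (fallλ R b l) n ⟩
      (∂ (fallλ R a l) ⊛ fallλ R b l) n + (fallλ R a l ⊛ ∂ (fallλ R b l)) n
    ≈⟨ +-cong (trans (⊛-cong {b = fallλ R b l} (∂-fallλ a l) (λ _ → refl) n) (·-⊛ a (fallλ R (a - l) l) (fallλ R b l) n))
              (trans (⊛-cong {a = fallλ R a l} (λ _ → refl) (∂-fallλ b l) n) (⊛-· b (fallλ R a l) (fallλ R (b - l) l) n)) ⟩
      a * (fallλ R (a - l) l ⊛ fallλ R b l) n + b * (fallλ R a l ⊛ fallλ R (b - l) l) n
    ≈⟨ +-cong (*-congˡ (trans (fallλ-vandermonde _ _ l n) (fallλ-cong l ([x+y]+z≈[x+z]+y a _ b) n)))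
              (*-congˡ (trans (fallλ-vandermonde _ _ l n) (fallλ-cong l (sym (+-assoc _ _ _)) n))) ⟩
      a * fallλ R ((a + b) - l) l n + b * fallλ R ((a + b) - l) l n
    ≈⟨ distribʳ _ _ _ ⟨
      (a + b) * fallλ R ((a + b) - l) l n
    ≈⟨ ∂-fallλ (a + b) l n ⟨
      fallλ R (a + b) l (suc n)
    ∎

  [λ-1]+[x-λ]≈x-1 : ∀ lam x → (lam - 1#) + (x - lam) ≈ x - 1#
  [λ-1]+[x-λ]≈x-1 lam x = trans
    (+-Solver.solve 4 (λ a m y n → (a +-Solver.⊕ m) +-Solver.⊕ (y +-Solver.⊕ n)
                                   +-Solver.⊜ (y +-Solver.⊕ m) +-Solver.⊕ (a +-Solver.⊕ n))
                      refl lam (- 1#) x (- lam))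
    (trans (+-congˡ (-‿inverseʳ lam)) (+-identityʳ _))

  -- e_λ^x(log_λ(1 + t)) = (1 + t)^x; note that ∂ (logλ R lam) is fallλ R (lam - 1#) 1#.
  fallλ-⊚-logλ : ∀ lam x → fallλ R x lam ⊚ logλ R lam ≋ fallλ R x 1#
  fallλ-⊚-logλ lam x n = <-rec Binomial step n x
    where
    L = logλ R lam
    Binomial : ℕ → Set _
    Binomial j = ∀ x → (fallλ R x lam ⊚ L) j ≈ fallλ R x 1# j
    step : ∀ j → (∀ {i} → i < j → Binomial i) → Binomial j
    step zero    _  x = *-identityˡ _
    step (suc j) ih x = begin
        (fallλ R x lam ⊚ L) (suc j)
      ≈⟨ ⊚-chainRule (fallλ R x lam) L j ⟩
        (∂ L ⊛ (∂ (fallλ R x lam) ⊚ L)) j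
      ≈⟨ ⊛-cong≤ {a = ∂ L} j (λ _ → refl) (λ {i} i≤j →
           trans (⊚-congˡ L (∂-fallλ x lam) i) (trans (·-⊚ x (fallλ R (x - lam) lam) L i)
                 (*-congˡ (ih (s≤s i≤j) (x - lam))))) ⟩
        (∂ L ⊛ (x · fallλ R (x - lam) 1#)) j
      ≈⟨ ⊛-· x (∂ L) (fallλ R (x - lam) 1#) j ⟩
        x * (fallλ R (lam - 1#) 1# ⊛ fallλ R (x - lam) 1#) j
      ≈⟨ *-congˡ (trans (fallλ-vandermonde (lam - 1#) (x - lam) 1# j) (fallλ-cong 1# ([λ-1]+[x-λ]≈x-1 lam x) j)) ⟩
        x * fallλ R (x - 1#) 1# j
      ≈⟨ ∂-fallλ x 1# j ⟨
        fallλ R x 1# (suc j)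
      ∎

  ∂-fallλ-1-1 : ∂ (fallλ R 1# 1#) ≋ ∂ ι
  ∂-fallλ-1-1 zero          = trans (∂-fallλ 1# 1# 0) (*-identityʳ _)
  ∂-fallλ-1-1 (suc zero)    =
    trans (*-congˡ (trans (+-congˡ (-‿cong (trans (*-identityʳ _) natR-1))) (-‿inverseʳ 1#))) (zeroʳ _)
  ∂-fallλ-1-1 (suc (suc j)) = trans (*-congʳ (∂-fallλ-1-1 (suc j))) (zeroˡ _)

  eλm1-⊚-logλ : ∀ lam → ∂ (eλm1 R lam ⊚ logλ R lam) ≋ ∂ ι
  eλm1-⊚-logλ lam j = begin
    (eλm1 R lam ⊚ logλ R lam) (suc j)          ≈⟨ ⊚-congˡ-∂ (logλ R lam) (λ _ → refl) j ⟩
    (fallλ R 1# lam ⊚ logλ R lam) (suc j)      ≈⟨ fallλ-⊚-logλ lam 1# (suc j) ⟩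
    fallλ R 1# 1# (suc j)                      ≈⟨ ∂-fallλ-1-1 j ⟩
    ι (suc j)                                  ∎

  eλeλm1m1-⊚-logλ : ∀ lam → ∂ (eλeλm1m1 R lam ⊚ logλ R lam) ≋ ∂ (eλm1 R lam)
  eλeλm1m1-⊚-logλ lam j = begin
    (eλeλm1m1 R lam ⊚ L) (suc j)     ≈⟨ ⊚-congˡ-∂ L (λ _ → refl) j ⟩
    ((E ⊚ eλm1 R lam) ⊚ L) (suc j)   ≈⟨ ⊚-assoc E (eλm1 R lam) L (suc j) ⟩
    (E ⊚ (eλm1 R lam ⊚ L)) (suc j)   ≈⟨ ⊚-congʳ E (eλm1-⊚-logλ lam) (suc j) ⟩
    (E ⊚ ι) (suc j)                  ≈⟨ ⊚-identityʳ E (suc j) ⟩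
    E (suc j)                        ∎
    where
    L = logλ R lam
    E = fallλ R 1# lam

  Bellλ≈Jindλ⊚logλ : ∀ lam x → Bellλ R lam x ≋ Jindλ R lam x ⊚ logλ R lam
  Bellλ≈Jindλ⊚logλ lam x n = begin
    Bellλ R lam x n                                                  ≈⟨ ⊚-congʳ E (eλeλm1m1-⊚-logλ lam) n ⟨
    (E ⊚ (eλeλm1m1 R lam ⊚ logλ R lam)) n                            ≈⟨ ⊚-assoc E (eλeλm1m1 R lam) (logλ R lam) n ⟨
    ((E ⊚ eλeλm1m1 R lam) ⊚ logλ R lam) n                            ∎
    where
    E = fallλ R x lam

theorem9 : ∀ {c ℓ : Level} (R : CommutativeRing c ℓ) (λ₀ x : CommutativeRing.Carrier R) →
    ¬ (CommutativeRing._≈_ R λ₀ (CommutativeRing.0# R)) → (n : ℕ) →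
    (CommutativeRing._≈_ R (Bellλ R λ₀ x n)
      (sumTo R (λ m → CommutativeRing._*_ R (Jindλ R λ₀ x m) (S1λ R λ₀ n m)) n))
    × (CommutativeRing._≈_ R (Bellλ R λ₀ (CommutativeRing.1# R) n)
      (sumTo R (λ m → CommutativeRing._*_ R (Jindλ R λ₀ (CommutativeRing.1# R) m) (S1λ R λ₀ n m)) n))
theorem9 R λ₀ x _ n = Bellλ≈Jindλ⊚logλ λ₀ x n , Bellλ≈Jindλ⊚logλ λ₀ 1# n
  where open ExponentialSeries R
        open CommutativeRing R using (1#)
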